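{- Let $m,n$ be nonnegative integers and suppose there is a perfect coloring of $D(m,n)$ with quotient matrix $S$. Let $k$ be a positive integer. 1. If $k$ is even, then for all nonnegative integers $m',n'$ with $2m'+n'=kn$ there is a perfect coloring of $D(mk+m',n')$ with quotient matrix $kS$. 2. If $k$ is odd, then for all nonnegative integers $m',n'$ with $2m'+n'=kn$ and $n'\ge n$ there is a perfect coloring of $D(mk+m',n')$ with quotient matrix $kS$.
   Context: The Shrikhande graph is the Cayley graph on $\mathbb{Z}_4^2$ with connection set $\{01,03,10,30,11,33\}$. For nonnegative integers $m,n$, $D(m,n)$ is the Cartesian product of $m$ copies of the Shrikhande graph and $n$ copies of $K_4$ (vertex set $(\mathbb{Z}_4^2)^m\times\mathbb{Z}_4^n$; adjacent iff differing in exactly one coordinate by an adjacency of that factor). A $k$-coloring is a surjective map onto a $k$-element color set; it is perfect with quotient matrix $S=(s_{ij})$ if every vertex of color $i$ has exactly $s_{ij}$ neighbours of color $j$. -}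

module Defs where

open import Data.Nat using (ℕ; zero; suc; _+_; _*_)
open import Data.Fin using (Fin; zero; suc; _-_)
open import Data.Fin.Properties using (_≟_)
open import Data.Bool using (Bool; true; false; _∧_; _∨_; not; if_then_else_)
open import Data.Product using (_×_; _,_; Σ; ∃)
open import Data.Vec using (Vec; []; _∷_)
open import Data.List using (List; []; _∷_; _++_; map; concatMap; length; filter; allFin)
open import Relation.Nullary using (does)
open import Relation.Binary.PropositionalEquality using (_≡_)
open import Function.Definitions using (Surjective)

Z4 : Set
Z4 = Fin 4

neg4 : Z4 → Z4
neg4 zero = zero
neg4 (suc zero) = suc (suc (suc zero))
neg4 (suc (suc zero)) = suc (suc zero)
neg4 (suc (suc (suc zero))) = suc zero

add4 : Z4 → Z4 → Z4
add4 zero y = y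
add4 (suc x) y = suc4 (add4' x y)
  where
  suc4 : Z4 → Z4
  suc4 zero = suc zero
  suc4 (suc zero) = suc (suc zero)
  suc4 (suc (suc zero)) = suc (suc (suc zero))
  suc4 (suc (suc (suc zero))) = zero
  add4' : Fin 3 → Z4 → Z4
  add4' zero y = y
  add4' (suc zero) y = suc4 y
  add4' (suc (suc zero)) y = suc4 (suc4 y)

sub4 : Z4 → Z4 → Z4
sub4 x y = add4 x (neg4 y)

eqZ4 : Z4 → Z4 → Bool
eqZ4 x y = does (x ≟ y)

-- elements of ℤ₄² as pairs (a , b), written "ab" in the paper
Z4² : Set
Z4² = Z4 × Z4

eqZ4² : Z4² → Z4² → Bool
eqZ4² (a , b) (c , d) = eqZ4 a c ∧ eqZ4 b d

inConn : Z4² → Bool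
inConn (zero , suc zero) = true
inConn (zero , suc (suc (suc zero))) = true
inConn (suc zero , zero) = true
inConn (suc (suc (suc zero)) , zero) = true
inConn (suc zero , suc zero) = true
inConn (suc (suc (suc zero)) , suc (suc (suc zero))) = true
inConn _ = false

adjShri : Z4² → Z4² → Bool
adjShri (a , b) (c , d) = inConn (sub4 c a , sub4 d b)

adjK4 : Z4 → Z4 → Bool
adjK4 x y = not (eqZ4 x y)

eqVec : ∀ {A : Set} {n} → (A → A → Bool) → Vec A n → Vec A n → Bool
eqVec eq [] [] = true
eqVec eq (x ∷ xs) (y ∷ ys) = eq x y ∧ eqVec eq xs ys

adjVec : ∀ {A : Set} {n} → (A → A → Bool) → (A → A → Bool) →
         Vec A n → Vec A n → Bool
adjVec eq adj [] [] = false
adjVec eq adj (x ∷ xs) (y ∷ ys) =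
  (adj x y ∧ eqVec eq xs ys) ∨ (eq x y ∧ adjVec eq adj xs ys)

Vertex : ℕ → ℕ → Set
Vertex m n = Vec Z4² m × Vec Z4 n

adjD : ∀ {m n} → Vertex m n → Vertex m n → Bool
adjD (xs , us) (ys , vs) =
  (adjVec eqZ4² adjShri xs ys ∧ eqVec eqZ4 us vs) ∨
  (eqVec eqZ4² xs ys ∧ adjVec eqZ4 adjK4 us vs)

allVec : ∀ {A : Set} → List A → (n : ℕ) → List (Vec A n)
allVec xs zero = [] ∷ []
allVec xs (suc n) = concatMap (λ x → map (x ∷_) (allVec xs n)) xs

allZ4² : List Z4²
allZ4² = concatMap (λ a → map (a ,_) (allFin 4)) (allFin 4)

allVertices : (m n : ℕ) → List (Vertex m n)
allVertices m n =
  concatMap (λ xs → map (xs ,_) (allVec (allFin 4) n)) (allVec allZ4² m)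

nbrsWithColour : ∀ {m n c} → (Vertex m n → Fin c) → Vertex m n → Fin c → ℕ
nbrsWithColour {m} {n} f v j =
  length (filter (λ w → adjD v w ∧ does (f w ≟ j) Data.Bool.≟ true)
                 (allVertices m n))
  where import Data.Bool

IsPerfectColouring : ∀ {m n c} → (Vertex m n → Fin c) → (Fin c → Fin c → ℕ) → Set
IsPerfectColouring {m} {n} {c} f S =
  Surjective _≡_ _≡_ f ×
  (∀ (v : Vertex m n) (j : Fin c) → nbrsWithColour f v j ≡ S (f v) j)

HasPerfectColouring : (m n c : ℕ) → (Fin c → Fin c → ℕ) → Set
HasPerfectColouring m n c S =
  Σ (Vertex m n → Fin c) λ f → IsPerfectColouring f S

scaleMat : ∀ {c} → ℕ → (Fin c → Fin c → ℕ) → Fin c → Fin c → ℕ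
scaleMat k S i j = k * S i j

-- A perfect colouring of D(m,n) with quotient matrix S pulls back along any surjection
-- ψ : D(a,b) → D(m,n) under which every neighbour of ψ v has exactly k preimages among
-- the neighbours of v, and the pulled-back colouring has quotient matrix k S.  Such maps
-- come from the group ℤ₄²: adding up k Shrikhande coordinates is one onto a single
-- Shrikhande factor, and (x , u) ↦ Σᵢ (xᵢ₁ + xᵢ₂) + Σⱼ uⱼ is one from D(a,b) onto K₄ with
-- k = 2a + b, because (x₁ , x₂) ↦ x₁ + x₂ maps the connection set {01,03,10,30,11,33}
-- onto each nonzero element of ℤ₄ exactly twice.  Products of such maps are again such
-- maps, so it remains to split (m′ , n′) into n blocks (a , b) with 2a + b = k; this is
-- always possible for even k, and for odd k when n ≤ n′, which leaves room for b ≥ 1 in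
-- every block.

module Submission where

open import Defs
open import Algebra.Properties.CommutativeSemigroup using (interchange)
open import Data.Bool using (Bool; true; false; _∧_; _∨_; if_then_else_)
import Data.Bool as Bool
open import Data.Fin using (Fin; zero; suc; #_)
open import Data.Fin.Properties using (_≟_; all?)
open import Data.List using (List; []; _∷_; _++_; map; concatMap; length; filter; allFin)
open import Data.List.Properties using (map-++; map-∘; map-cong; map-tabulate)
open import Data.Nat as ℕ using (ℕ; zero; suc; _+_; _*_; _≤_; _≤?_; z≤n; s≤s)
open import Data.Nat.Divisibility using (_∣_; divides)
open import Data.Nat.DivMod using (_%_; _/_; m≡m%n+[m/n]*n; m%n<n)
open import Data.Nat.ListAction using (sum)
open import Data.Nat.ListAction.Properties using (sum-++)
open import Data.Nat.Properties hiding (_≟_)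
open import Data.Nat.Tactic.RingSolver using (solve-∀)
open import Data.Product using (_×_; _,_; ∃-syntax; proj₁; proj₂; curry)
open import Data.Vec using (Vec; []; _∷_; foldr′; replicate; take; drop; splitAt)
  renaming (_++_ to _++ᵛ_)
open import Data.Vec.Properties using (take++drop≡id; ++-injectiveˡ; ++-injectiveʳ)
open import Function using (_∘_; id)
open import Function.Definitions using (Surjective; StrictlySurjective)
open import Function.Consequences.Propositional using (strictlySurjective⇒surjective)
import Function.Construct.Composition as Composition
open import Relation.Nullary using (does; ¬_; yes; no; contradiction)
open import Relation.Nullary.Decidable using (toWitness; _→-dec_)
open import Relation.Binary.PropositionalEquality hiding ([_])

private
  variable
    A B C : Set
    k a b c m n a′ b′ m′ n′ : ℕ
    S : Fin c → Fin c → ℕ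

+-interchange : ∀ w x y z → (w + x) + (y + z) ≡ (w + y) + (x + z)
+-interchange = interchange +-commutativeSemigroup

∑ : List A → (A → ℕ) → ℕ
∑ xs g = sum (map g xs)

infix 5 ∑
syntax ∑ xs (λ x → e) = ∑[ x ∈ xs ] e

infixr 8 [_]·_

[_]·_ : Bool → ℕ → ℕ
[ p ]· n = if p then n else 0

∑-cong : (xs : List A) {g h : A → ℕ} → (∀ x → g x ≡ h x) → ∑ xs g ≡ ∑ xs h
∑-cong xs g≗h = cong sum (map-cong g≗h xs)

∑-zero : (xs : List A) → ∑[ x ∈ xs ] 0 ≡ 0
∑-zero []       = refl
∑-zero (_ ∷ xs) = ∑-zero xs

∑-++ : (xs ys : List A) (g : A → ℕ) → ∑ (xs ++ ys) g ≡ ∑ xs g + ∑ ys g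
∑-++ xs ys g = trans (cong sum (map-++ g xs ys)) (sum-++ (map g xs) (map g ys))

∑-map : (f : A → B) (xs : List A) (g : B → ℕ) → ∑ (map f xs) g ≡ ∑ xs (g ∘ f)
∑-map f xs g = cong sum (sym (map-∘ xs))

∑-pairs : (f : A → B → C) (xs : List A) (ys : List B) (g : C → ℕ) →
          ∑ (concatMap (λ x → map (f x) ys) xs) g ≡ ∑[ x ∈ xs ] ∑[ y ∈ ys ] g (f x y)
∑-pairs f []       ys g = refl
∑-pairs f (x ∷ xs) ys g =
  trans (∑-++ (map (f x) ys) _ g) (cong₂ _+_ (∑-map (f x) ys g) (∑-pairs f xs ys g))

∑-+ : (xs : List A) (g h : A → ℕ) → ∑[ x ∈ xs ] (g x + h x) ≡ ∑ xs g + ∑ xs h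
∑-+ []       g h = refl
∑-+ (x ∷ xs) g h =
  trans (cong (g x + h x +_) (∑-+ xs g h)) (+-interchange (g x) (h x) _ _)

∑-*ʳ : (xs : List A) (g : A → ℕ) (n : ℕ) → ∑[ x ∈ xs ] (g x * n) ≡ ∑ xs g * n
∑-*ʳ []       g n = refl
∑-*ʳ (x ∷ xs) g n = trans (cong (g x * n +_) (∑-*ʳ xs g n)) (sym (*-distribʳ-+ n (g x) _))

∑-comm : (xs : List A) (ys : List B) (g : A → B → ℕ) →
         ∑[ x ∈ xs ] ∑[ y ∈ ys ] g x y ≡ ∑[ y ∈ ys ] ∑[ x ∈ xs ] g x y
∑-comm []       ys g = sym (∑-zero ys)
∑-comm (x ∷ xs) ys g = trans (cong (∑ ys (g x) +_) (∑-comm xs ys g)) (sym (∑-+ ys (g x) _))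

∑-[]· : (xs : List A) (p : Bool) (g : A → ℕ) → ∑[ x ∈ xs ] [ p ]· g x ≡ [ p ]· ∑ xs g
∑-[]· xs true  g = refl
∑-[]· xs false g = ∑-zero xs

[]·-∧ : ∀ p q n → [ p ∧ q ]· n ≡ [ p ]· [ q ]· n
[]·-∧ true  q n = refl
[]·-∧ false q n = refl

[]·-∨ : ∀ p q r s n → (p ≡ true → r ≡ false) →
        [ (p ∧ q) ∨ (r ∧ s) ]· n ≡ [ p ]· [ q ]· n + [ r ]· [ s ]· n
[]·-∨ true  true  r s n p⇒¬r rewrite p⇒¬r refl = sym (+-identityʳ n)
[]·-∨ true  false r s n p⇒¬r = []·-∧ r s n
[]·-∨ false q     r s n p⇒¬r = []·-∧ r s n

[]·-1 : ∀ p n → [ p ]· n ≡ [ p ]· 1 * n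
[]·-1 true  n = sym (*-identityˡ n)
[]·-1 false n = refl

length-filter-≡true : (p : A → Bool) (xs : List A) →
                      length (filter (λ x → p x Bool.≟ true) xs) ≡ ∑[ x ∈ xs ] [ p x ]· 1
length-filter-≡true p []       = refl
length-filter-≡true p (x ∷ xs) with p x
... | true  = cong suc (length-filter-≡true p xs)
... | false = length-filter-≡true p xs

-- Counting neighbourhoods

-- eq x acts as the Kronecker delta at x on xs: x occurs in xs exactly once, and eq x y
-- fails for every other entry y.
record Enumerates (xs : List A) (eq : A → A → Bool) : Set where
  field
    ∑-δ : ∀ x (g : A → ℕ) → ∑[ y ∈ xs ] [ eq x y ]· g y ≡ g x

open Enumerates

∑-allFin-suc : ∀ n (g : Fin (suc n) → ℕ) → ∑ (allFin (suc n)) g ≡ g zero + ∑ (allFin n) (g ∘ suc)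
∑-allFin-suc n g =
  cong (g zero +_) (cong sum (trans (map-tabulate suc g) (sym (map-tabulate id (g ∘ suc)))))

allFin-enumerates : ∀ n → Enumerates (allFin n) (λ i j → does (i ≟ j))
allFin-enumerates (suc n) .∑-δ zero    g =
  trans (∑-allFin-suc n _) (trans (cong (g zero +_) (∑-zero (allFin n))) (+-identityʳ _))
allFin-enumerates (suc n) .∑-δ (suc i) g =
  trans (∑-allFin-suc n (λ j → [ does (suc i ≟ j) ]· g j)) (∑-δ (allFin-enumerates n) i (g ∘ suc))

enumerates-pairs : {xs : List A} {ys : List B} {eqA : A → A → Bool} {eqB : B → B → Bool} →
                   Enumerates xs eqA → Enumerates ys eqB → ∀ x y (g : A → B → ℕ) →
                   ∑[ x′ ∈ xs ] ∑[ y′ ∈ ys ] [ eqA x x′ ∧ eqB y y′ ]· g x′ y′ ≡ g x y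
enumerates-pairs {xs = xs} {ys} {eqA} {eqB} enumA enumB x y g = begin
    ∑[ x′ ∈ xs ] ∑[ y′ ∈ ys ] [ eqA x x′ ∧ eqB y y′ ]· g x′ y′
  ≡⟨ ∑-cong xs (λ x′ → trans (∑-cong ys (λ y′ → []·-∧ (eqA x x′) _ _)) (∑-[]· ys (eqA x x′) _)) ⟩
    ∑[ x′ ∈ xs ] [ eqA x x′ ]· (∑[ y′ ∈ ys ] [ eqB y y′ ]· g x′ y′)
  ≡⟨ ∑-cong xs (λ x′ → cong ([ eqA x x′ ]·_) (∑-δ enumB y (g x′))) ⟩
    ∑[ x′ ∈ xs ] [ eqA x x′ ]· g x′ y
  ≡⟨ ∑-δ enumA x (λ x′ → g x′ y) ⟩
    g x y
  ∎ where open ≡-Reasoning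

record CountingGraph (V : Set) : Set where
  field
    vertices        : List V
    equal adjacent  : V → V → Bool
    ∑nbr            : V → (V → ℕ) → ℕ
    enumerates      : Enumerates vertices equal
    ∑-adjacent      : ∀ v g → ∑[ w ∈ vertices ] [ adjacent v w ]· g w ≡ ∑nbr v g
    adjacent⇒¬equal : ∀ v w → adjacent v w ≡ true → equal v w ≡ false

open CountingGraph

module _ (G : CountingGraph A) (H : CountingGraph B) where

  ∑-productAdjacent :
    ∀ x y (g : A → B → ℕ) →
    ∑[ x′ ∈ vertices G ] ∑[ y′ ∈ vertices H ]
      [ (adjacent G x x′ ∧ equal H y y′) ∨ (equal G x x′ ∧ adjacent H y y′) ]· g x′ y′
    ≡ ∑nbr G x (λ x′ → g x′ y) + ∑nbr H y (g x)
  ∑-productAdjacent x y g = begin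
      ∑[ x′ ∈ vertices G ] ∑[ y′ ∈ vertices H ]
        [ (adjacent G x x′ ∧ equal H y y′) ∨ (equal G x x′ ∧ adjacent H y y′) ]· g x′ y′
    ≡⟨ ∑-cong (vertices G) (λ x′ → trans (∑-cong (vertices H) (λ y′ →
         []·-∨ (adjacent G x x′) _ (equal G x x′) _ _ (adjacent⇒¬equal G x x′)))
         (∑-+ (vertices H) _ _)) ⟩
      ∑[ x′ ∈ vertices G ] ((∑[ y′ ∈ vertices H ] [ adjacent G x x′ ]· [ equal H y y′ ]· g x′ y′)
                          + (∑[ y′ ∈ vertices H ] [ equal G x x′ ]· [ adjacent H y y′ ]· g x′ y′))
    ≡⟨ ∑-+ (vertices G) _ _ ⟩
      (∑[ x′ ∈ vertices G ] ∑[ y′ ∈ vertices H ] [ adjacent G x x′ ]· [ equal H y y′ ]· g x′ y′)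
      + (∑[ x′ ∈ vertices G ] ∑[ y′ ∈ vertices H ] [ equal G x x′ ]· [ adjacent H y y′ ]· g x′ y′)
    ≡⟨ cong₂ _+_
         (∑-cong (vertices G) (λ x′ → trans (∑-[]· (vertices H) (adjacent G x x′) _)
           (cong ([ adjacent G x x′ ]·_) (∑-δ (enumerates H) y (g x′)))))
         (∑-cong (vertices G) (λ x′ → trans (∑-[]· (vertices H) (equal G x x′) _)
           (cong ([ equal G x x′ ]·_) (∑-adjacent H y (g x′))))) ⟩
      (∑[ x′ ∈ vertices G ] [ adjacent G x x′ ]· g x′ y)
      + (∑[ x′ ∈ vertices G ] [ equal G x x′ ]· ∑nbr H y (g x′))
    ≡⟨ cong₂ _+_ (∑-adjacent G x (λ x′ → g x′ y)) (∑-δ (enumerates G) x (λ x′ → ∑nbr H y (g x′))) ⟩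
      ∑nbr G x (λ x′ → g x′ y) + ∑nbr H y (g x)
    ∎ where open ≡-Reasoning

  productAdjacent⇒¬equal :
    ∀ x y x′ y′ → (adjacent G x x′ ∧ equal H y y′) ∨ (equal G x x′ ∧ adjacent H y y′) ≡ true →
    equal G x x′ ∧ equal H y y′ ≡ false
  productAdjacent⇒¬equal x y x′ y′ adj with adjacent G x x′ in x~x′
  ... | true rewrite adjacent⇒¬equal G x x′ x~x′ = refl
  ... | false with equal G x x′
  ...   | false = refl
  ...   | true  = adjacent⇒¬equal H y y′ adj

infixr 6 _×ᴳ_

_×ᴳ_ : CountingGraph A → CountingGraph B → CountingGraph (A × B)
G ×ᴳ H = record
  { vertices        = concatMap (λ x → map (x ,_) (vertices H)) (vertices G)
  ; equal           = λ (x , y) (x′ , y′) → equal G x x′ ∧ equal H y y′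
  ; adjacent        = λ (x , y) (x′ , y′) →
                        (adjacent G x x′ ∧ equal H y y′) ∨ (equal G x x′ ∧ adjacent H y y′)
  ; ∑nbr            = λ (x , y) g → ∑nbr G x (λ x′ → g (x′ , y)) + ∑nbr H y (λ y′ → g (x , y′))
  ; enumerates      = record { ∑-δ = λ (x , y) g → trans (∑-pairs _,_ (vertices G) (vertices H) _)
                        (enumerates-pairs (enumerates G) (enumerates H) x y (curry g)) }
  ; ∑-adjacent      = λ (x , y) g → trans (∑-pairs _,_ (vertices G) (vertices H) _)
                        (∑-productAdjacent G H x y (curry g))
  ; adjacent⇒¬equal = λ (x , y) (x′ , y′) → productAdjacent⇒¬equal G H x y x′ y′
  }

∑nbrᵛ : (A → (A → ℕ) → ℕ) → Vec A n → (Vec A n → ℕ) → ℕ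
∑nbrᵛ nbr []       g = 0
∑nbrᵛ nbr (x ∷ xs) g = nbr x (λ y → g (y ∷ xs)) + ∑nbrᵛ nbr xs (λ ys → g (x ∷ ys))

∑nbrᵛ-cong : {nbr : A → (A → ℕ) → ℕ} →
             (∀ x {g h} → (∀ y → g y ≡ h y) → nbr x g ≡ nbr x h) →
             (xs : Vec A n) {g h : Vec A n → ℕ} → (∀ ys → g ys ≡ h ys) →
             ∑nbrᵛ nbr xs g ≡ ∑nbrᵛ nbr xs h
∑nbrᵛ-cong nbr-cong []       g≗h = refl
∑nbrᵛ-cong nbr-cong (x ∷ xs) g≗h =
  cong₂ _+_ (nbr-cong x (λ y → g≗h (y ∷ xs))) (∑nbrᵛ-cong nbr-cong xs (λ ys → g≗h (x ∷ ys)))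

∑nbrᵛ-++ : (nbr : A → (A → ℕ) → ℕ) (xs : Vec A m) (ys : Vec A n) (g : Vec A (m + n) → ℕ) →
           ∑nbrᵛ nbr (xs ++ᵛ ys) g
           ≡ ∑nbrᵛ nbr xs (λ zs → g (zs ++ᵛ ys)) + ∑nbrᵛ nbr ys (λ zs → g (xs ++ᵛ zs))
∑nbrᵛ-++ nbr []       ys g = refl
∑nbrᵛ-++ nbr (x ∷ xs) ys g =
  trans (cong (nbr x _ +_) (∑nbrᵛ-++ nbr xs ys (λ zs → g (x ∷ zs)))) (sym (+-assoc (nbr x _) _ _))

infixl 8 _^ᴳ_

_^ᴳ_ : CountingGraph A → (n : ℕ) → CountingGraph (Vec A n)
enumeratesᵛ : (G : CountingGraph A) → ∀ n → Enumerates (allVec (vertices G) n) (eqVec (equal G))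
∑-adjacentᵛ : (G : CountingGraph A) → ∀ n (xs : Vec A n) g →
              ∑[ ys ∈ allVec (vertices G) n ] [ adjVec (equal G) (adjacent G) xs ys ]· g ys
              ≡ ∑nbrᵛ (∑nbr G) xs g
adjacent⇒¬equalᵛ : (G : CountingGraph A) → ∀ n (xs ys : Vec A n) →
                   adjVec (equal G) (adjacent G) xs ys ≡ true → eqVec (equal G) xs ys ≡ false

G ^ᴳ n = record
  { vertices        = allVec (vertices G) n
  ; equal           = eqVec (equal G)
  ; adjacent        = adjVec (equal G) (adjacent G)
  ; ∑nbr            = ∑nbrᵛ (∑nbr G)
  ; enumerates      = enumeratesᵛ G n
  ; ∑-adjacent      = ∑-adjacentᵛ G n
  ; adjacent⇒¬equal = adjacent⇒¬equalᵛ G n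
  }

enumeratesᵛ G zero    .∑-δ []       g = +-identityʳ (g [])
enumeratesᵛ G (suc n) .∑-δ (x ∷ xs) g = trans (∑-pairs _∷_ (vertices G) _ _)
  (enumerates-pairs (enumerates G) (enumeratesᵛ G n) x xs (λ y ys → g (y ∷ ys)))

∑-adjacentᵛ G zero    []       g = refl
∑-adjacentᵛ G (suc n) (x ∷ xs) g = trans (∑-pairs _∷_ (vertices G) _ _)
  (∑-productAdjacent G (G ^ᴳ n) x xs (λ y ys → g (y ∷ ys)))

adjacent⇒¬equalᵛ G zero    []       []       ()
adjacent⇒¬equalᵛ G (suc n) (x ∷ xs) (y ∷ ys) = productAdjacent⇒¬equal G (G ^ᴳ n) x xs y ys

cayleyNbr : (A → A → A) → List A → A → (A → ℕ) → ℕ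
cayleyNbr _+_ cs x g = ∑[ c ∈ cs ] g (x + c)

cayleyNbr-cong : (_+_ : A → A → A) (cs : List A) →
                 ∀ x {g h} → (∀ y → g y ≡ h y) → cayleyNbr _+_ cs x g ≡ cayleyNbr _+_ cs x h
cayleyNbr-cong _+_ cs x g≗h = ∑-cong cs (λ c → g≗h (x + c))

cayleyNbr-translate : (_+_ : A → A → A) (cs : List A) →
                      (∀ x y z → (x + y) + z ≡ x + (y + z)) →
                      ∀ t x R → cayleyNbr _+_ cs x (R ∘ (t +_)) ≡ cayleyNbr _+_ cs (t + x) R
cayleyNbr-translate _+_ cs +-assoc t x R = ∑-cong cs (λ c → cong R (sym (+-assoc t x c)))

-- The hypothesis on cs says that y is x + c for exactly one c ∈ cs when adj x y, and for
-- none otherwise.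
∑-cayley : {xs : List A} {eq : A → A → Bool} → Enumerates xs eq →
           (_+_ : A → A → A) (cs : List A) (adj : A → A → Bool) →
           (∀ x y → ∑[ c ∈ cs ] [ eq (x + c) y ]· 1 ≡ [ adj x y ]· 1) →
           ∀ x g → ∑[ y ∈ xs ] [ adj x y ]· g y ≡ cayleyNbr _+_ cs x g
∑-cayley {xs = xs} {eq} enum _+_ cs adj count x g = begin
    ∑[ y ∈ xs ] [ adj x y ]· g y
  ≡⟨ ∑-cong xs (λ y → trans ([]·-1 (adj x y) (g y)) (cong (_* g y) (sym (count x y)))) ⟩
    ∑[ y ∈ xs ] (∑[ c ∈ cs ] [ eq (x + c) y ]· 1) * g y
  ≡⟨ ∑-cong xs (λ y → sym (trans (∑-cong cs (λ c → []·-1 (eq (x + c) y) (g y)))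
                                 (∑-*ʳ cs _ (g y)))) ⟩
    ∑[ y ∈ xs ] ∑[ c ∈ cs ] [ eq (x + c) y ]· g y
  ≡⟨ ∑-comm xs cs _ ⟩
    ∑[ c ∈ cs ] ∑[ y ∈ xs ] [ eq (x + c) y ]· g y
  ≡⟨ ∑-cong cs (λ c → ∑-δ enum (x + c) g) ⟩
    cayleyNbr _+_ cs x g
  ∎ where open ≡-Reasoning

cayley : (xs : List A) (eq : A → A → Bool) → Enumerates xs eq →
         (_+_ : A → A → A) (cs : List A) (adj : A → A → Bool) →
         (∀ x y → ∑[ c ∈ cs ] [ eq (x + c) y ]· 1 ≡ [ adj x y ]· 1) →
         (∀ x y → adj x y ≡ true → eq x y ≡ false) → CountingGraph A
cayley xs eq enum _+_ cs adj count adj⇒¬eq = record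
  { vertices        = xs
  ; equal           = eq
  ; adjacent        = adj
  ; ∑nbr            = cayleyNbr _+_ cs
  ; enumerates      = enum
  ; ∑-adjacent      = ∑-cayley enum _+_ cs adj count
  ; adjacent⇒¬equal = adj⇒¬eq
  }

-- Maps summing the coordinates of a vector in a Cayley graph

foldr′-replicate : (_+_ : A → A → A) (e : A) → e + e ≡ e → ∀ n → foldr′ _+_ e (replicate n e) ≡ e
foldr′-replicate _+_ e e+e≡e zero    = refl
foldr′-replicate _+_ e e+e≡e (suc n) =
  trans (cong (e +_) (foldr′-replicate _+_ e e+e≡e n)) e+e≡e

module CoordinateSum
  {A B : Set} (_+ᴬ_ : A → A → A) (0ᴬ : A) (Cᴬ : List A)
  (_+ᴮ_ : B → B → B) (Cᴮ : List B)
  (+ᴮ-assoc : ∀ x y z → (x +ᴮ y) +ᴮ z ≡ x +ᴮ (y +ᴮ z))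
  (+ᴮ-comm : ∀ x y → x +ᴮ y ≡ y +ᴮ x)
  (φ : A → B) (φ-hom : ∀ x y → φ (x +ᴬ y) ≡ φ x +ᴮ φ y)
  (w : ℕ) (φ-Cᴬ : ∀ (R : B → ℕ) → ∑[ c ∈ Cᴬ ] R (φ c) ≡ w * ∑ Cᴮ R)
  where

  sumᵛ : Vec A n → A
  sumᵛ = foldr′ _+ᴬ_ 0ᴬ

  ∑nbrᵛ-sumᵛ : (xs : Vec A n) (R : B → ℕ) →
               ∑nbrᵛ (cayleyNbr _+ᴬ_ Cᴬ) xs (R ∘ φ ∘ sumᵛ)
               ≡ (n * w) * cayleyNbr _+ᴮ_ Cᴮ (φ (sumᵛ xs)) R
  ∑nbrᵛ-sumᵛ []                 R = refl
  ∑nbrᵛ-sumᵛ {suc n} (x ∷ xs) R = begin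
      (∑[ c ∈ Cᴬ ] R (φ ((x +ᴬ c) +ᴬ s))) + ∑nbrᵛ nbrᴬ xs (λ ys → R (φ (x +ᴬ sumᵛ ys)))
    ≡⟨ cong₂ _+_ first (∑nbrᵛ-cong (cayleyNbr-cong _+ᴬ_ Cᴬ) xs (λ ys → cong R (φ-hom x _))) ⟩
      w * N + ∑nbrᵛ nbrᴬ xs (R ∘ (φ x +ᴮ_) ∘ φ ∘ sumᵛ)
    ≡⟨ cong (w * N +_) (∑nbrᵛ-sumᵛ xs (R ∘ (φ x +ᴮ_))) ⟩
      w * N + (n * w) * cayleyNbr _+ᴮ_ Cᴮ (φ s) (R ∘ (φ x +ᴮ_))
    ≡⟨ cong (λ M → w * N + (n * w) * M)
         (trans (cayleyNbr-translate _+ᴮ_ Cᴮ +ᴮ-assoc (φ x) (φ s) R)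
                (cong (λ t → cayleyNbr _+ᴮ_ Cᴮ t R) (sym (φ-hom x s)))) ⟩
      w * N + (n * w) * N
    ≡⟨ sym (*-distribʳ-+ N w (n * w)) ⟩
      (suc n * w) * N
    ∎
    where
    open ≡-Reasoning
    nbrᴬ = cayleyNbr _+ᴬ_ Cᴬ
    s = sumᵛ xs
    N = cayleyNbr _+ᴮ_ Cᴮ (φ (x +ᴬ s)) R
    swap : ∀ c → φ ((x +ᴬ c) +ᴬ s) ≡ φ (x +ᴬ s) +ᴮ φ c
    swap c = begin
        φ ((x +ᴬ c) +ᴬ s)        ≡⟨ trans (φ-hom _ s) (cong (_+ᴮ φ s) (φ-hom x c)) ⟩
        (φ x +ᴮ φ c) +ᴮ φ s      ≡⟨ +ᴮ-assoc (φ x) (φ c) (φ s) ⟩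
        φ x +ᴮ (φ c +ᴮ φ s)      ≡⟨ cong (φ x +ᴮ_) (+ᴮ-comm (φ c) (φ s)) ⟩
        φ x +ᴮ (φ s +ᴮ φ c)      ≡⟨ sym (trans (cong (_+ᴮ φ c) (φ-hom x s)) (+ᴮ-assoc _ _ _)) ⟩
        φ (x +ᴬ s) +ᴮ φ c        ∎
    first : ∑[ c ∈ Cᴬ ] R (φ ((x +ᴬ c) +ᴬ s)) ≡ w * N
    first = trans (∑-cong Cᴬ (λ c → cong R (swap c))) (φ-Cᴬ (R ∘ (φ (x +ᴬ s) +ᴮ_)))

infixl 6 _+₄_ _+²_

_+₄_ : Z4 → Z4 → Z4
_+₄_ = add4

+₄-comm : ∀ x y → x +₄ y ≡ y +₄ x
+₄-comm = toWitness {a? = all? λ x → all? λ y → _ ≟ _} _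

+₄-assoc : ∀ x y z → (x +₄ y) +₄ z ≡ x +₄ (y +₄ z)
+₄-assoc = toWitness {a? = all? λ x → all? λ y → all? λ z → _ ≟ _} _

+₄-identityʳ : ∀ x → x +₄ zero ≡ x
+₄-identityʳ = toWitness {a? = all? λ x → _ ≟ _} _

+₄-interchange : ∀ w x y z → (w +₄ x) +₄ (y +₄ z) ≡ (w +₄ y) +₄ (x +₄ z)
+₄-interchange = toWitness {a? = all? λ w → all? λ x → all? λ y → all? λ z → _ ≟ _} _

_+²_ : Z4² → Z4² → Z4²
(x₁ , x₂) +² (y₁ , y₂) = x₁ +₄ y₁ , x₂ +₄ y₂

0² : Z4²
0² = zero , zero

+²-comm : ∀ x y → x +² y ≡ y +² x
+²-comm (x₁ , x₂) (y₁ , y₂) = cong₂ _,_ (+₄-comm x₁ y₁) (+₄-comm x₂ y₂)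

+²-assoc : ∀ x y z → (x +² y) +² z ≡ x +² (y +² z)
+²-assoc (x₁ , x₂) (y₁ , y₂) (z₁ , z₂) = cong₂ _,_ (+₄-assoc x₁ y₁ z₁) (+₄-assoc x₂ y₂ z₂)

+²-identityʳ : ∀ x → x +² 0² ≡ x
+²-identityʳ (x₁ , x₂) = cong₂ _,_ (+₄-identityʳ x₁) (+₄-identityʳ x₂)

sum² : Z4² → Z4
sum² (x₁ , x₂) = x₁ +₄ x₂

sum²-hom : ∀ x y → sum² (x +² y) ≡ sum² x +₄ sum² y
sum²-hom (x₁ , x₂) (y₁ , y₂) = +₄-interchange x₁ y₁ x₂ y₂

shrikhandeConnection : List Z4²
shrikhandeConnection =
  (# 0 , # 1) ∷ (# 0 , # 3) ∷ (# 1 , # 0) ∷ (# 3 , # 0) ∷ (# 1 , # 1) ∷ (# 3 , # 3) ∷ []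

k₄Connection : List Z4
k₄Connection = # 1 ∷ # 2 ∷ # 3 ∷ []

sum²-shrikhandeConnection : ∀ (R : Z4 → ℕ) →
                            ∑[ c ∈ shrikhandeConnection ] R (sum² c) ≡ 2 * ∑ k₄Connection R
sum²-shrikhandeConnection R = lemma (R (# 1)) (R (# 2)) (R (# 3))
  where
  lemma : ∀ r₁ r₂ r₃ → r₁ + (r₃ + (r₁ + (r₃ + (r₂ + (r₂ + 0))))) ≡ 2 * (r₁ + (r₂ + (r₃ + 0)))
  lemma = solve-∀

allZ4²-enumerates : Enumerates allZ4² eqZ4²
allZ4²-enumerates .∑-δ (x₁ , x₂) g =
  trans (∑-pairs _,_ (allFin 4) (allFin 4) (λ y → [ eqZ4² (x₁ , x₂) y ]· g y))
  (enumerates-pairs (allFin-enumerates 4) (allFin-enumerates 4) x₁ x₂ (curry g))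

shrikhande : CountingGraph Z4²
shrikhande = cayley allZ4² eqZ4² allZ4²-enumerates _+²_ shrikhandeConnection adjShri
  (λ (x₁ , x₂) (y₁ , y₂) → count x₁ x₂ y₁ y₂)
  (λ (x₁ , x₂) (y₁ , y₂) → irreflexive x₁ x₂ y₁ y₂)
  where
  count : ∀ x₁ x₂ y₁ y₂ → ∑[ c ∈ shrikhandeConnection ] [ eqZ4² ((x₁ , x₂) +² c) (y₁ , y₂) ]· 1
                          ≡ [ adjShri (x₁ , x₂) (y₁ , y₂) ]· 1
  count = toWitness {a? = all? λ _ → all? λ _ → all? λ _ → all? λ _ → _ ℕ.≟ _} _
  irreflexive : ∀ x₁ x₂ y₁ y₂ → adjShri (x₁ , x₂) (y₁ , y₂) ≡ true →
                eqZ4² (x₁ , x₂) (y₁ , y₂) ≡ false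
  irreflexive = toWitness
    {a? = all? λ _ → all? λ _ → all? λ _ → all? λ _ → (_ Bool.≟ _) →-dec (_ Bool.≟ _)} _

k₄ : CountingGraph Z4
k₄ = cayley (allFin 4) eqZ4 (allFin-enumerates 4) _+₄_ k₄Connection adjK4 count irreflexive
  where
  count : ∀ x y → ∑[ c ∈ k₄Connection ] [ eqZ4 (x +₄ c) y ]· 1 ≡ [ adjK4 x y ]· 1
  count = toWitness {a? = all? λ _ → all? λ _ → _ ℕ.≟ _} _
  irreflexive : ∀ x y → adjK4 x y ≡ true → eqZ4 x y ≡ false
  irreflexive = toWitness {a? = all? λ _ → all? λ _ → (_ Bool.≟ _) →-dec (_ Bool.≟ _)} _

module ShrikhandeSum = CoordinateSum _+²_ 0² shrikhandeConnection _+²_ shrikhandeConnection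
  +²-assoc +²-comm id (λ _ _ → refl) 1 (λ R → sym (*-identityˡ _))

module ShrikhandeToK₄ = CoordinateSum _+²_ 0² shrikhandeConnection _+₄_ k₄Connection
  +₄-assoc +₄-comm sum² sum²-hom 2 sum²-shrikhandeConnection

module K₄Sum = CoordinateSum _+₄_ zero k₄Connection _+₄_ k₄Connection
  +₄-assoc +₄-comm id (λ _ _ → refl) 1 (λ R → sym (*-identityˡ _))

-- Covers between the graphs D(m,n)

D : (m n : ℕ) → CountingGraph (Vertex m n)
D m n = shrikhande ^ᴳ m ×ᴳ k₄ ^ᴳ n

∑nbrᴰ-cong : (v : Vertex m n) {g h : Vertex m n → ℕ} → (∀ w → g w ≡ h w) →
             ∑nbr (D m n) v g ≡ ∑nbr (D m n) v h
∑nbrᴰ-cong (xs , us) g≗h = cong₂ _+_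
  (∑nbrᵛ-cong (cayleyNbr-cong _+²_ shrikhandeConnection) xs (λ ys → g≗h (ys , us)))
  (∑nbrᵛ-cong (cayleyNbr-cong _+₄_ k₄Connection) us (λ ws → g≗h (xs , ws)))

nbrsWithColour≡∑nbr : (f : Vertex m n → Fin c) (v : Vertex m n) (j : Fin c) →
                      nbrsWithColour f v j ≡ ∑nbr (D m n) v (λ w → [ does (f w ≟ j) ]· 1)
nbrsWithColour≡∑nbr {m = m} {n = n} f v j = begin
    nbrsWithColour f v j
  ≡⟨ length-filter-≡true (λ w → adjD v w ∧ does (f w ≟ j)) (allVertices m n) ⟩
    ∑[ w ∈ allVertices m n ] [ adjD v w ∧ does (f w ≟ j) ]· 1
  ≡⟨ ∑-cong (allVertices m n) (λ w → []·-∧ (adjD v w) _ 1) ⟩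
    ∑[ w ∈ allVertices m n ] [ adjD v w ]· [ does (f w ≟ j) ]· 1
  ≡⟨ ∑-adjacent (D m n) v _ ⟩
    ∑nbr (D m n) v (λ w → [ does (f w ≟ j) ]· 1)
  ∎ where open ≡-Reasoning

-- Taking P an indicator function: every neighbour of to v has exactly k preimages among
-- the neighbours of v, and every neighbour of v is mapped to a neighbour of to v.
record Cover (k a b m n : ℕ) : Set where
  field
    to                 : Vertex a b → Vertex m n
    strictlySurjective : StrictlySurjective _≡_ to
    ∑nbr-∘to           : ∀ v (P : Vertex m n → ℕ) →
                         ∑nbr (D a b) v (P ∘ to) ≡ k * ∑nbr (D m n) (to v) P

open Cover

pullback : Cover k a b m n → HasPerfectColouring m n c S →
           HasPerfectColouring a b c (scaleMat k S)
pullback {k = k} {a = a} {b = b} {m = m} {n = n} {S = S} ψ (f , f-surjective , f-perfect) =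
  f ∘ to ψ , surjective , perfect
  where
  surjective : Surjective _≡_ _≡_ (f ∘ to ψ)
  surjective = Composition.surjective _≡_ _≡_ _≡_
    (strictlySurjective⇒surjective (strictlySurjective ψ)) f-surjective
  perfect : ∀ v j → nbrsWithColour (f ∘ to ψ) v j ≡ k * S (f (to ψ v)) j
  perfect v j = begin
      nbrsWithColour (f ∘ to ψ) v j
    ≡⟨ nbrsWithColour≡∑nbr (f ∘ to ψ) v j ⟩
      ∑nbr (D a b) v (λ w → [ does (f (to ψ w) ≟ j) ]· 1)
    ≡⟨ ∑nbr-∘to ψ v (λ u → [ does (f u ≟ j) ]· 1) ⟩
      k * ∑nbr (D m n) (to ψ v) (λ u → [ does (f u ≟ j) ]· 1)
    ≡⟨ cong (k *_) (sym (nbrsWithColour≡∑nbr f (to ψ v) j)) ⟩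
      k * nbrsWithColour f (to ψ v) j
    ≡⟨ cong (k *_) (f-perfect (to ψ v) j) ⟩
      k * S (f (to ψ v)) j
    ∎ where open ≡-Reasoning

Cover-∅ : Cover k 0 0 0 0
Cover-∅ {k = k} = record
  { to                 = id
  ; strictlySurjective = λ u → u , refl
  ; ∑nbr-∘to           = λ { ([] , []) P → sym (*-zeroʳ k) }
  }

take-++ : (xs : Vec A m) (ys : Vec A n) → take m (xs ++ᵛ ys) ≡ xs
take-++ {m = m} xs ys = sym (++-injectiveˡ xs _ (proj₂ (proj₂ (splitAt m (xs ++ᵛ ys)))))

drop-++ : (xs : Vec A m) (ys : Vec A n) → drop m (xs ++ᵛ ys) ≡ ys
drop-++ {m = m} xs ys = sym (++-injectiveʳ xs _ (proj₂ (proj₂ (splitAt m (xs ++ᵛ ys)))))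

joinᴰ : Vertex a b → Vertex a′ b′ → Vertex (a + a′) (b + b′)
joinᴰ (xs , us) (ys , ws) = xs ++ᵛ ys , us ++ᵛ ws

splitᴰ : ∀ a b → Vertex (a + a′) (b + b′) → Vertex a b × Vertex a′ b′
splitᴰ a b (xs , us) = (take a xs , take b us) , (drop a xs , drop b us)

splitᴰ-joinᴰ : (v : Vertex a b) (w : Vertex a′ b′) → splitᴰ a b (joinᴰ v w) ≡ (v , w)
splitᴰ-joinᴰ (xs , us) (ys , ws)
  rewrite take-++ xs ys | take-++ us ws | drop-++ xs ys | drop-++ us ws = refl

joinᴰ-splitᴰ : ∀ a b (v : Vertex (a + a′) (b + b′)) →
               joinᴰ (proj₁ (splitᴰ a b v)) (proj₂ (splitᴰ a b v)) ≡ v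
joinᴰ-splitᴰ a b (xs , us) = cong₂ _,_ (take++drop≡id a xs) (take++drop≡id b us)

∑nbr-joinᴰ : (v : Vertex a b) (w : Vertex a′ b′) (g : Vertex (a + a′) (b + b′) → ℕ) →
             ∑nbr (D (a + a′) (b + b′)) (joinᴰ v w) g
             ≡ ∑nbr (D a b) v (λ t → g (joinᴰ t w)) + ∑nbr (D a′ b′) w (g ∘ joinᴰ v)
∑nbr-joinᴰ (xs , us) (ys , ws) g =
  trans (cong₂ _+_ (∑nbrᵛ-++ _ xs ys (λ zs → g (zs , us ++ᵛ ws)))
                   (∑nbrᵛ-++ _ us ws (λ zs → g (xs ++ᵛ ys , zs))))
        (+-interchange (∑nbrᵛ _ xs (λ zs → g (zs ++ᵛ ys , us ++ᵛ ws))) _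
                       (∑nbrᵛ _ us (λ zs → g (xs ++ᵛ ys , zs ++ᵛ ws))) _)

infixr 5 _⊗_

_⊗_ : Cover k a b m n → Cover k a′ b′ m′ n′ → Cover k (a + a′) (b + b′) (m + m′) (n + n′)
_⊗_ {k = k} {a = a} {b = b} {m = m} {n = n} {a′ = a′} {b′ = b′} {m′ = m′} {n′ = n′} ψ₁ ψ₂ = record
  { to                 = ψ
  ; strictlySurjective = onto
  ; ∑nbr-∘to           = λ v P → subst (λ v → ∑nbr (D _ _) v (P ∘ ψ) ≡ k * ∑nbr (D _ _) (ψ v) P)
                           (joinᴰ-splitᴰ a b v)
                           (cover (proj₁ (splitᴰ a b v)) (proj₂ (splitᴰ a b v)) P)
  }
  where
  ψ : Vertex (a + a′) (b + b′) → Vertex (m + m′) (n + n′)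
  ψ v = joinᴰ (to ψ₁ (proj₁ (splitᴰ a b v))) (to ψ₂ (proj₂ (splitᴰ a b v)))

  ψ-joinᴰ : ∀ v₁ v₂ → ψ (joinᴰ v₁ v₂) ≡ joinᴰ (to ψ₁ v₁) (to ψ₂ v₂)
  ψ-joinᴰ v₁ v₂ = cong (λ (u₁ , u₂) → joinᴰ (to ψ₁ u₁) (to ψ₂ u₂)) (splitᴰ-joinᴰ v₁ v₂)

  onto : StrictlySurjective _≡_ ψ
  onto u = joinᴰ v₁ v₂ ,
    trans (ψ-joinᴰ v₁ v₂) (trans (cong₂ joinᴰ ψ₁v₁≡u₁ ψ₂v₂≡u₂) (joinᴰ-splitᴰ m n u))
    where
    v₁ = proj₁ (strictlySurjective ψ₁ (proj₁ (splitᴰ m n u)))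
    ψ₁v₁≡u₁ = proj₂ (strictlySurjective ψ₁ (proj₁ (splitᴰ m n u)))
    v₂ = proj₁ (strictlySurjective ψ₂ (proj₂ (splitᴰ m n u)))
    ψ₂v₂≡u₂ = proj₂ (strictlySurjective ψ₂ (proj₂ (splitᴰ m n u)))

  cover : ∀ v₁ v₂ P → ∑nbr (D _ _) (joinᴰ v₁ v₂) (P ∘ ψ) ≡ k * ∑nbr (D _ _) (ψ (joinᴰ v₁ v₂)) P
  cover v₁ v₂ P = begin
      ∑nbr (D _ _) (joinᴰ v₁ v₂) (P ∘ ψ)
    ≡⟨ ∑nbr-joinᴰ v₁ v₂ (P ∘ ψ) ⟩
      ∑nbr (D a b) v₁ (λ t → P (ψ (joinᴰ t v₂))) + ∑nbr (D a′ b′) v₂ (λ t → P (ψ (joinᴰ v₁ t)))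
    ≡⟨ cong₂ _+_ (∑nbrᴰ-cong v₁ (λ t → cong P (ψ-joinᴰ t v₂)))
                 (∑nbrᴰ-cong v₂ (λ t → cong P (ψ-joinᴰ v₁ t))) ⟩
      ∑nbr (D a b) v₁ (λ t → P (joinᴰ (to ψ₁ t) u₂))
      + ∑nbr (D a′ b′) v₂ (λ t → P (joinᴰ u₁ (to ψ₂ t)))
    ≡⟨ cong₂ _+_ (∑nbr-∘to ψ₁ v₁ (λ t → P (joinᴰ t u₂))) (∑nbr-∘to ψ₂ v₂ (P ∘ joinᴰ u₁)) ⟩
      k * ∑nbr (D m n) u₁ (λ t → P (joinᴰ t u₂)) + k * ∑nbr (D m′ n′) u₂ (P ∘ joinᴰ u₁)
    ≡⟨ sym (*-distribˡ-+ k _ _) ⟩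
      k * (∑nbr (D m n) u₁ (λ t → P (joinᴰ t u₂)) + ∑nbr (D m′ n′) u₂ (P ∘ joinᴰ u₁))
    ≡⟨ cong (k *_) (sym (trans (cong (λ u → ∑nbr (D _ _) u P) (ψ-joinᴰ v₁ v₂))
                               (∑nbr-joinᴰ u₁ u₂ P))) ⟩
      k * ∑nbr (D _ _) (ψ (joinᴰ v₁ v₂)) P
    ∎
    where
    open ≡-Reasoning
    u₁ = to ψ₁ v₁
    u₂ = to ψ₂ v₂

shrikhande-sum-cover : ∀ k → Cover (suc k) (suc k) 0 1 0
shrikhande-sum-cover k = record
  { to                 = λ (xs , _) → sumᵛ xs ∷ [] , []
  ; strictlySurjective = λ { (s ∷ [] , []) → (s ∷ replicate k 0² , []) ,
      cong (λ t → t ∷ [] , []) (trans (cong (s +²_) (foldr′-replicate _+²_ 0² refl k))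
                                      (+²-identityʳ s)) }
  ; ∑nbr-∘to           = λ { (xs , []) P → trans
      (cong (_+ 0) (∑nbrᵛ-sumᵛ xs (λ s → P (s ∷ [] , []))))
      (rearrange (suc k) (cayleyNbr _+²_ shrikhandeConnection (sumᵛ xs) (λ s → P (s ∷ [] , [])))) }
  }
  where
  open ShrikhandeSum
  rearrange : ∀ k N → (k * 1) * N + 0 ≡ k * ((N + 0) + 0)
  rearrange = solve-∀

k₄-map : Vertex a b → Vertex 0 1
k₄-map (xs , us) = [] , sum² (ShrikhandeToK₄.sumᵛ xs) +₄ K₄Sum.sumᵛ us ∷ []

k₄-map-onto : ∀ a b → 1 ≤ 2 * a + b → StrictlySurjective _≡_ (k₄-map {a} {b})
k₄-map-onto (suc a) b _ ([] , z ∷ []) = ((zero , z) ∷ replicate a 0² , replicate b zero) ,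
  cong (λ t → [] , t ∷ []) (begin
      sum² ((zero , z) +² ShrikhandeToK₄.sumᵛ (replicate a 0²)) +₄ K₄Sum.sumᵛ (replicate b zero)
    ≡⟨ cong₂ (λ x y → sum² ((zero , z) +² x) +₄ y)
         (foldr′-replicate _+²_ 0² refl a) (foldr′-replicate _+₄_ zero refl b) ⟩
      (z +₄ zero) +₄ zero
    ≡⟨ trans (+₄-identityʳ _) (+₄-identityʳ z) ⟩
      z
    ∎)
  where open ≡-Reasoning
k₄-map-onto zero (suc b) _ ([] , z ∷ []) = ([] , z ∷ replicate b zero) ,
  cong (λ t → [] , t ∷ [])
    (trans (cong (z +₄_) (foldr′-replicate _+₄_ zero refl b)) (+₄-identityʳ z))
k₄-map-onto zero zero ()

∑nbr-∘k₄-map : (v : Vertex a b) (P : Vertex 0 1 → ℕ) →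
               ∑nbr (D a b) v (P ∘ k₄-map) ≡ (2 * a + b) * ∑nbr (D 0 1) (k₄-map v) P
∑nbr-∘k₄-map {a = a} {b = b} (xs , us) P = begin
    ∑nbrᵛ (∑nbr shrikhande) xs (λ ys → Q (sum² (S.sumᵛ ys) +₄ t))
    + ∑nbrᵛ (∑nbr k₄) us (λ ws → Q (s +₄ K.sumᵛ ws))
  ≡⟨ cong (_+ ∑nbrᵛ (∑nbr k₄) us (λ ws → Q (s +₄ K.sumᵛ ws)))
       (∑nbrᵛ-cong (cayleyNbr-cong _+²_ shrikhandeConnection) xs
         (λ ys → cong Q (+₄-comm (sum² (S.sumᵛ ys)) t))) ⟩
    ∑nbrᵛ (∑nbr shrikhande) xs (λ ys → Q (t +₄ sum² (S.sumᵛ ys)))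
    + ∑nbrᵛ (∑nbr k₄) us (λ ws → Q (s +₄ K.sumᵛ ws))
  ≡⟨ cong₂ _+_ (S.∑nbrᵛ-sumᵛ xs (Q ∘ (t +₄_))) (K.∑nbrᵛ-sumᵛ us (Q ∘ (s +₄_))) ⟩
    (a * 2) * nbrK s (Q ∘ (t +₄_)) + (b * 1) * nbrK t (Q ∘ (s +₄_))
  ≡⟨ cong₂ (λ M M′ → (a * 2) * M + (b * 1) * M′)
       (trans (translate t s Q) (cong (λ x → nbrK x Q) (+₄-comm t s))) (translate s t Q) ⟩
    (a * 2) * nbrK (s +₄ t) Q + (b * 1) * nbrK (s +₄ t) Q
  ≡⟨ rearrange a b (nbrK (s +₄ t) Q) ⟩
    (2 * a + b) * (nbrK (s +₄ t) Q + 0)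
  ∎
  where
  open ≡-Reasoning
  module S = ShrikhandeToK₄
  module K = K₄Sum
  nbrK = cayleyNbr _+₄_ k₄Connection
  translate = cayleyNbr-translate _+₄_ k₄Connection +₄-assoc
  s = sum² (S.sumᵛ xs)
  t = K.sumᵛ us
  Q : Z4 → ℕ
  Q z = P ([] , z ∷ [])
  rearrange : ∀ a b N → (a * 2) * N + (b * 1) * N ≡ (2 * a + b) * (N + 0)
  rearrange = solve-∀

k₄-cover : ∀ a b → 1 ≤ 2 * a + b → Cover (2 * a + b) a b 0 1
k₄-cover a b 1≤2a+b = record
  { to                 = k₄-map
  ; strictlySurjective = k₄-map-onto a b 1≤2a+b
  ; ∑nbr-∘to           = ∑nbr-∘k₄-map
  }

shrikhande-power-cover : ∀ m k → Cover (suc k) (m * suc k) 0 m 0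
shrikhande-power-cover zero    k = Cover-∅
shrikhande-power-cover (suc m) k = shrikhande-sum-cover k ⊗ shrikhande-power-cover m k

-- Splitting (m′ , n′) into n blocks (a , b) with 2a + b = k

data Blocks (k : ℕ) : ℕ → ℕ → ℕ → Set where
  []    : Blocks k 0 0 0
  block : ∀ a b {n m′ n′} → 2 * a + b ≡ k → Blocks k n m′ n′ → Blocks k (suc n) (a + m′) (b + n′)

blocks-cover : 1 ≤ k → Blocks k n m′ n′ → Cover k m′ n′ 0 n
blocks-cover 1≤k []                   = Cover-∅
blocks-cover 1≤k (block a b refl bs) = k₄-cover a b 1≤k ⊗ blocks-cover 1≤k bs

blocks-zero : 2 * m′ + n′ ≡ 0 → Blocks k 0 m′ n′
blocks-zero {m′ = zero}  {n′ = zero}  refl = []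
blocks-zero {m′ = zero}  {n′ = suc _} ()
blocks-zero {m′ = suc _}              ()

-- Greedily take a = min(h, m′) in each block; the remaining blocks then still satisfy
-- the hypotheses.
blocks : ∀ h r → k ≡ 2 * h + r → 2 * m′ + n′ ≡ k * n → r * n ≤ n′ → Blocks k n m′ n′
blocks {k = k} {n = zero} h r _ e _ = blocks-zero (trans e (*-zeroʳ k))
blocks {m′ = m′} {n′ = n′} {n = suc n} h r refl e r[1+n]≤n′ with h ≤? m′
... | yes h≤m′ with m″ , refl ← m≤n⇒∃[o]m+o≡n h≤m′
                 | n″ , refl ← m≤n⇒∃[o]m+o≡n (m+n≤o⇒m≤o r (subst (_≤ n′) (*-suc r n) r[1+n]≤n′)) =
  block h r refl (blocks h r refl e′ (+-cancelˡ-≤ r _ _ (subst (_≤ r + n″) (*-suc r n) r[1+n]≤n′)))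
  where
  e′ : 2 * m″ + n″ ≡ (2 * h + r) * n
  e′ = +-cancelˡ-≡ (2 * h + r) _ _ (trans (regroup h m″ r n″) (trans e (*-suc (2 * h + r) n)))
    where
    regroup : ∀ h m r n → 2 * h + r + (2 * m + n) ≡ 2 * (h + m) + (r + n)
    regroup = solve-∀
... | no h≰m′ with o , refl ← m≤n⇒∃[o]m+o≡n (≰⇒> h≰m′) =
  subst₂ (Blocks (2 * h + r) (suc n)) (+-identityʳ m′) (sym n′≡)
    (block m′ (2 * suc o + r) (regroup m′ o r)
      (blocks h r refl refl (*-monoˡ-≤ n (m≤n+m r (2 * h)))))
  where
  regroup : ∀ m o r → 2 * m + (2 * (1 + o) + r) ≡ 2 * (1 + m + o) + r
  regroup = solve-∀
  n′≡ : n′ ≡ 2 * suc o + r + (2 * h + r) * n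
  n′≡ = +-cancelˡ-≡ (2 * m′) _ _ (trans e (trans (*-suc (2 * h + r) n) (regroup′ m′ o r _)))
    where
    regroup′ : ∀ m o r x → 2 * (1 + m + o) + r + x ≡ 2 * m + (2 * (1 + o) + r + x)
    regroup′ = solve-∀

odd⇒2h+1 : ¬ 2 ∣ k → ∃[ h ] k ≡ 2 * h + 1
odd⇒2h+1 {k = k} 2∤k with k % 2 | m≡m%n+[m/n]*n k 2 | m%n<n k 2
... | zero        | k≡ | _ = contradiction (divides (k / 2) k≡) 2∤k
... | suc zero    | k≡ | _ = k / 2 , trans k≡ (regroup (k / 2))
  where
  regroup : ∀ h → 1 + h * 2 ≡ 2 * h + 1
  regroup = solve-∀
... | suc (suc _) | _  | s≤s (s≤s ())

colouring-from-blocks : HasPerfectColouring m n c S → 1 ≤ k → Blocks k n m′ n′ →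
                        HasPerfectColouring (m * k + m′) n′ c (scaleMat k S)
colouring-from-blocks {m = m} {S = S} {k = suc k} colouring _ bs = pullback {S = S}
  (subst (λ x → Cover (suc k) (m * suc k + _) _ x _) (+-identityʳ m)
    (shrikhande-power-cover m k ⊗ blocks-cover (s≤s z≤n) bs))
  colouring

proposition6 : (m n c : ℕ) (S : Fin c → Fin c → ℕ) →
    HasPerfectColouring m n c S →
    (k : ℕ) → 1 ≤ k →
    ((2 ∣ k → (m′ n′ : ℕ) → 2 * m′ + n′ ≡ k * n →
        HasPerfectColouring (m * k + m′) n′ c (scaleMat k S))
    × (¬ (2 ∣ k) → (m′ n′ : ℕ) → 2 * m′ + n′ ≡ k * n → n ≤ n′ →
        HasPerfectColouring (m * k + m′) n′ c (scaleMat k S)))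
proposition6 m n c S colouring k 1≤k = even , odd
  where
  Goal : ℕ → ℕ → Set
  Goal m′ n′ = HasPerfectColouring (m * k + m′) n′ c (scaleMat k S)
  even : 2 ∣ k → ∀ m′ n′ → 2 * m′ + n′ ≡ k * n → Goal m′ n′
  even (divides q k≡q*2) m′ n′ e = colouring-from-blocks {S = S} colouring 1≤k
    (blocks q 0 (trans k≡q*2 (trans (*-comm q 2) (sym (+-identityʳ _)))) e z≤n)
  odd : ¬ 2 ∣ k → ∀ m′ n′ → 2 * m′ + n′ ≡ k * n → n ≤ n′ → Goal m′ n′
  odd 2∤k m′ n′ e n≤n′ =
    colouring-from-blocks {S = S} colouring 1≤k
      (blocks (proj₁ (odd⇒2h+1 2∤k)) 1 (proj₂ (odd⇒2h+1 2∤k)) e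
        (≤-trans (≤-reflexive (*-identityˡ n)) n≤n′))
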